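{- Let $a_n=A_{0123}(n)$. Then $a_0=a_1=1$, $a_2=2$, and $$a_n=5a_{n-1}-6a_{n-2}+a_{n-3},\qquad n\ge 3.$$
   Context: An ascent in a sequence $x_1\cdots x_k$ is an index $j$ with $x_j<x_{j+1}$; $\mathrm{asc}(x)$ is the number of ascents. An ascent sequence of length $n$ is a sequence $x_1\cdots x_n$ of non-negative integers with $x_1=0$ and $x_i\le \mathrm{asc}(x_1\cdots x_{i-1})+1$ for $1<i\le n$; the empty sequence is the unique ascent sequence of length $0$. A sequence $\pi$ contains a pattern $\tau=\tau_1\cdots\tau_m$ (a sequence of non-negative integers) if there are indices $f(1)<\cdots<f(m)$ such that for all $i,j$: $\pi_{f(i)}<\pi_{f(j)}$ iff $\tau_i<\tau_j$, and $\pi_{f(i)}>\pi_{f(j)}$ iff $\tau_i>\tau_j$; otherwise $\pi$ avoids $\tau$. $A_\tau(n)$ is the number of ascent sequences of length $n$ avoiding $\tau$. -}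

module Defs where

open import Data.Nat using (ℕ; zero; suc; _+_; _<ᵇ_; _≤ᵇ_)
open import Data.Bool using (Bool; true; false; _∧_; _∨_; not; if_then_else_)
open import Data.List using (List; []; _∷_; _++_; length; map; filter; concatMap; upTo; zip)
open import Relation.Nullary.Decidable using (does)
open import Relation.Binary.PropositionalEquality using (_≡_)
open import Data.Bool.Properties using () renaming (_≟_ to _≟ᵇ_)
open import Data.Nat.Properties using () renaming (_≟_ to _≟ℕ_)

_==ᵇ_ : Bool → Bool → Bool
a ==ᵇ b = does (a ≟ᵇ b)

ascFrom : ℕ → List ℕ → ℕ
ascFrom x [] = 0
ascFrom x (y ∷ ys) = (if x <ᵇ y then 1 else 0) + ascFrom y ys

asc : List ℕ → ℕ
asc [] = 0
asc (x ∷ xs) = ascFrom x xs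

allB : {A : Set} → (A → Bool) → List A → Bool
allB p [] = true
allB p (x ∷ xs) = p x ∧ allB p xs

anyB : {A : Set} → (A → Bool) → List A → Bool
anyB p [] = false
anyB p (x ∷ xs) = p x ∨ anyB p xs

-- checkFrom pre ys: every entry y of ys, with prefix pre read before it,
-- satisfies the ascent-sequence condition: y = 0 if pre is empty
-- (x_1 = 0), and y ≤ asc(pre) + 1 otherwise.
checkFrom : List ℕ → List ℕ → Bool
checkFrom pre [] = true
checkFrom [] (y ∷ ys) = (y ≤ᵇ 0) ∧ checkFrom (y ∷ []) ys
checkFrom pre@(_ ∷ _) (y ∷ ys) = (y ≤ᵇ suc (asc pre)) ∧ checkFrom (pre ++ y ∷ []) ys

isAscentSeq : List ℕ → Bool
isAscentSeq x = checkFrom [] x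

listsOf : ℕ → ℕ → List (List ℕ)
listsOf b zero = [] ∷ []
listsOf b (suc n) = concatMap (λ x → map (x ∷_) (listsOf b n)) (upTo b)

-- all ascent sequences of length n (entries of an ascent sequence of
-- length n are at most n - 1 < n + 1, so listsOf (suc n) n is a superset)
ascentSeqs : ℕ → List (List ℕ)
ascentSeqs n = filter (λ x → isAscentSeq x Data.Bool.≟ true) (listsOf (suc n) n)

subseqs : List ℕ → List (List ℕ)
subseqs [] = [] ∷ []
subseqs (x ∷ xs) = map (x ∷_) (subseqs xs) ++ subseqs xs

orderIso : List ℕ → List ℕ → Bool
orderIso s τ =
  does (length s ≟ℕ length τ) ∧
  allB (λ p → allB (λ q → agree p q) ps) ps
  where
    open Data.List using (zip)
    open import Data.Product using (_×_; _,_)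
    ps = zip s τ
    agree : ℕ × ℕ → ℕ × ℕ → Bool
    agree (a , c) (b , d) = ((a <ᵇ b) ==ᵇ (c <ᵇ d)) ∧ ((b <ᵇ a) ==ᵇ (d <ᵇ c))

contains : List ℕ → List ℕ → Bool
contains π τ = anyB (λ s → orderIso s τ) (subseqs π)

avoids : List ℕ → List ℕ → Bool
avoids π τ = not (contains π τ)

A : List ℕ → ℕ → ℕ
A τ n = length (filter (λ x → avoids x τ Data.Bool.≟ true) (ascentSeqs n))

-- After its leading 0, an ascent sequence avoiding 0123 is read in two phases. While every entry is at most 1,
-- the state is the number a of ascents together with the last entry, and avoidance only forbids a later
-- increasing pair of entries ≥ 2. Once an entry b ≥ 2 appears (necessarily b ≤ a + 1), avoidance says that no
-- later entry exceeds b and that the later entries ≥ 2 weakly decrease; the ascent condition then holds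
-- automatically. Counting continuations from each state gives families U_α, V_α (first phase, α ascents, last
-- entry 1 resp. 0), G_c (second phase, c admissible values ≥ 2) and S_α = Σ_{j<α} G_{j+1}, related by
-- first-order recurrences in the length. In generating functions each family satisfies
-- (1 − 3x) X_{α+1} = (1 − 2x) X_α up to the constant term, by induction on the length. Together with
-- (1 − x) U_0 = 1 + x V_0 and (1 − x) V_0 = 1 + x U_1 this gives (1 − 5x + 6x² − x³) V_0 = 1 − 3x + x², and
-- A_{0123}(n + 1) is the coefficient of xⁿ in V_0.

module Submission where

open import Defs
open import Data.Nat using (ℕ; zero; suc; _≤_; _<_; _∸_; z≤n; s≤s; _≤ᵇ_; _<ᵇ_)
open import Data.Nat.ListAction using (sum)
open import Data.Bool using (Bool; true; false; _∧_; _∨_; not; if_then_else_; T)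
open import Data.List using (List; []; _∷_; _++_; map; concatMap; applyUpTo; length; filter)
open import Data.Product using (_×_; _,_)
open import Data.Unit using (tt)
open import Data.Empty using (⊥-elim)
open import Function.Bundles using (module Equivalence)
open import Relation.Binary.PropositionalEquality

open Equivalence using (to; from)

module Booleans where
  open import Data.Nat.Properties using (<⇒<ᵇ; <ᵇ⇒<; ≤⇒≤ᵇ; <⇒≱; ≰⇒>)
  open import Data.Bool.Properties using (∧-zeroʳ; T-≡)

  T-ext : ∀ {x y} → (T x → T y) → (T y → T x) → x ≡ y
  T-ext {false} {false} _ _ = refl
  T-ext {false} {true} _ y⇒x = ⊥-elim (y⇒x tt)
  T-ext {true} {false} x⇒y _ = ⊥-elim (x⇒y tt)
  T-ext {true} {true} _ _ = refl

  ∨-absorbˡ : ∀ {x y} → (T x → T y) → x ∨ y ≡ y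
  ∨-absorbˡ {false} _ = refl
  ∨-absorbˡ {true} {true} _ = refl
  ∨-absorbˡ {true} {false} x⇒y = ⊥-elim (x⇒y tt)

  ∨-absorbʳ : ∀ {x y} → (T y → T x) → x ∨ y ≡ x
  ∨-absorbʳ {true} _ = refl
  ∨-absorbʳ {false} {false} _ = refl
  ∨-absorbʳ {false} {true} y⇒x = ⊥-elim (y⇒x tt)

  ∧-absorbˡ : ∀ {x y} → (y ≡ true → x ≡ true) → x ∧ y ≡ y
  ∧-absorbˡ {y = false} _ = ∧-zeroʳ _
  ∧-absorbˡ {y = true} y⇒x rewrite y⇒x refl = refl

  <ᵇ-true : ∀ {m n} → m < n → (m <ᵇ n) ≡ true
  <ᵇ-true m<n = to T-≡ (<⇒<ᵇ m<n)

  <ᵇ-false : ∀ {m n} → n ≤ m → (m <ᵇ n) ≡ false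
  <ᵇ-false {m} {n} n≤m with m <ᵇ n in m<ᵇn
  ... | false = refl
  ... | true = ⊥-elim (<⇒≱ (<ᵇ⇒< m n (subst T (sym m<ᵇn) tt)) n≤m)

  ≤ᵇ-true : ∀ {m n} → m ≤ n → (m ≤ᵇ n) ≡ true
  ≤ᵇ-true m≤n = to T-≡ (≤⇒≤ᵇ m≤n)

  ≤ᵇ-false⇒> : ∀ {m n} → (m ≤ᵇ n) ≡ false → n < m
  ≤ᵇ-false⇒> m≰n = ≰⇒> (λ m≤n → subst T m≰n (≤⇒≤ᵇ m≤n))

module Counting where
  open import Data.Nat using (_+_)
  open import Data.Nat.Properties using (+-identityʳ)
  open import Data.Nat.ListAction.Properties using (sum-++)
  open import Data.List using (_∷ʳ_)
  open import Data.List.Properties using (applyUpTo-∷ʳ)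
  import Data.Bool as Bool

  count : {A : Set} → (A → Bool) → List A → ℕ
  count p [] = 0
  count p (x ∷ xs) = if p x then suc (count p xs) else count p xs

  count-++ : ∀ {A : Set} (p : A → Bool) xs ys → count p (xs ++ ys) ≡ count p xs + count p ys
  count-++ p [] ys = refl
  count-++ p (x ∷ xs) ys with p x
  ... | true = cong suc (count-++ p xs ys)
  ... | false = count-++ p xs ys

  count-map : ∀ {A B : Set} (p : B → Bool) (f : A → B) xs → count p (map f xs) ≡ count (λ x → p (f x)) xs
  count-map p f [] = refl
  count-map p f (x ∷ xs) rewrite count-map p f xs = refl

  count-cong : ∀ {A : Set} {p q : A → Bool} → (∀ x → p x ≡ q x) → ∀ xs → count p xs ≡ count q xs
  count-cong e [] = refl
  count-cong e (x ∷ xs) rewrite e x | count-cong e xs = refl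

  count-none : ∀ {A : Set} {p : A → Bool} → (∀ x → p x ≡ false) → ∀ xs → count p xs ≡ 0
  count-none e [] = refl
  count-none e (x ∷ xs) rewrite e x = count-none e xs

  length-filter-filter : ∀ {A : Set} (p q : A → Bool) xs →
    length (filter (λ x → q x Bool.≟ true) (filter (λ x → p x Bool.≟ true) xs)) ≡ count (λ x → p x ∧ q x) xs
  length-filter-filter p q [] = refl
  length-filter-filter p q (x ∷ xs) with p x
  ... | false = length-filter-filter p q xs
  ... | true with q x
  ...   | true = cong suc (length-filter-filter p q xs)
  ...   | false = length-filter-filter p q xs

  sum-applyUpTo-suc : ∀ (f : ℕ → ℕ) n → sum (applyUpTo f (suc n)) ≡ sum (applyUpTo f n) + f n
  sum-applyUpTo-suc f n = begin
    sum (applyUpTo f (suc n))       ≡⟨ cong sum (applyUpTo-∷ʳ f n) ⟨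
    sum (applyUpTo f n ∷ʳ f n)      ≡⟨ sum-++ (applyUpTo f n) (f n ∷ []) ⟩
    sum (applyUpTo f n) + (f n + 0) ≡⟨ cong (sum (applyUpTo f n) +_) (+-identityʳ (f n)) ⟩
    sum (applyUpTo f n) + f n       ∎
    where open ≡-Reasoning

  sum-applyUpTo-cong : ∀ {f g : ℕ → ℕ} n → (∀ j → j < n → f j ≡ g j) →
    sum (applyUpTo f n) ≡ sum (applyUpTo g n)
  sum-applyUpTo-cong zero e = refl
  sum-applyUpTo-cong (suc n) e =
    cong₂ _+_ (e 0 (s≤s z≤n)) (sum-applyUpTo-cong n (λ j j<n → e (suc j) (s≤s j<n)))

  sum-applyUpTo-zeros : ∀ {f : ℕ → ℕ} n → (∀ j → f j ≡ 0) → sum (applyUpTo f n) ≡ 0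
  sum-applyUpTo-zeros zero e = refl
  sum-applyUpTo-zeros (suc n) e rewrite e 0 = sum-applyUpTo-zeros n (λ j → e (suc j))

  sum-applyUpTo-truncate : ∀ {f : ℕ → ℕ} {m n} → m ≤ n → (∀ j → m ≤ j → f j ≡ 0) →
    sum (applyUpTo f n) ≡ sum (applyUpTo f m)
  sum-applyUpTo-truncate {n = n} z≤n e = sum-applyUpTo-zeros n (λ j → e j z≤n)
  sum-applyUpTo-truncate {f} (s≤s m≤n) e =
    cong (f 0 +_) (sum-applyUpTo-truncate m≤n (λ j m≤j → e (suc j) (s≤s m≤j)))

  count-prefixed : ∀ (p : List ℕ → Bool) L (g : ℕ → ℕ) n →
    count p (concatMap (λ y → map (y ∷_) L) (applyUpTo g n))
      ≡ sum (applyUpTo (λ j → count (λ xs → p (g j ∷ xs)) L) n)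
  count-prefixed p L g zero = refl
  count-prefixed p L g (suc n) = begin
    count p (map (g 0 ∷_) L ++ concatMap (λ y → map (y ∷_) L) (applyUpTo (λ j → g (suc j)) n))
      ≡⟨ count-++ p (map (g 0 ∷_) L) _ ⟩
    count p (map (g 0 ∷_) L) + count p (concatMap (λ y → map (y ∷_) L) (applyUpTo (λ j → g (suc j)) n))
      ≡⟨ cong₂ _+_ (count-map p (g 0 ∷_) L) (count-prefixed p L (λ j → g (suc j)) n) ⟩
    count (λ xs → p (g 0 ∷ xs)) L + sum (applyUpTo (λ j → count (λ xs → p (g (suc j) ∷ xs)) L) n) ∎
    where open ≡-Reasoning

  count-listsOf-suc : ∀ {B} k {m} (p : List ℕ → Bool) → m ≤ B → (∀ y xs → m ≤ y → p (y ∷ xs) ≡ false) →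
    count p (listsOf B (suc k)) ≡ sum (applyUpTo (λ y → count (λ xs → p (y ∷ xs)) (listsOf B k)) m)
  count-listsOf-suc {B} k {m} p m≤B dead = begin
    count p (listsOf B (suc k))
      ≡⟨ count-prefixed p (listsOf B k) (λ y → y) B ⟩
    sum (applyUpTo (λ y → count (λ xs → p (y ∷ xs)) (listsOf B k)) B)
      ≡⟨ sum-applyUpTo-truncate m≤B (λ y m≤y → count-none (λ xs → dead y xs m≤y) (listsOf B k)) ⟩
    sum (applyUpTo (λ y → count (λ xs → p (y ∷ xs)) (listsOf B k)) m) ∎
    where open ≡-Reasoning

module IncreasingSubsequences where
  open import Data.Nat.Properties using (<ᵇ⇒<; ≤ᵇ⇒≤; ≤⇒≤ᵇ; <-trans; <⇒≤; ≤-refl; ≤-trans)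
  open import Data.Bool.Properties using (∨-assoc; ∨-zeroʳ; T-∧; T-∨)
  open import Data.List.Relation.Unary.All using (All; []; _∷_)
  import Data.List.Relation.Unary.All as All
  open import Data.Sum using (inj₁; inj₂)
  open Booleans

  increasing : ℕ → ℕ → List ℕ → Bool
  increasing zero lo [] = true
  increasing zero lo (_ ∷ _) = false
  increasing (suc k) lo [] = false
  increasing (suc k) lo (x ∷ s) = (lo ≤ᵇ x) ∧ increasing k (suc x) s

  hasIncreasing : ℕ → ℕ → List ℕ → Bool
  hasIncreasing zero lo xs = true
  hasIncreasing (suc k) lo [] = false
  hasIncreasing (suc k) lo (x ∷ xs) = ((lo ≤ᵇ x) ∧ hasIncreasing k (suc x) xs) ∨ hasIncreasing (suc k) lo xs

  hasIncreasing-mono : ∀ k {lo lo′} xs → lo′ ≤ lo → T (hasIncreasing k lo xs) → T (hasIncreasing k lo′ xs)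
  hasIncreasing-mono zero xs _ _ = tt
  hasIncreasing-mono (suc k) {lo} (x ∷ xs) lo′≤lo t with to T-∨ t
  ... | inj₁ now with lo≤x , rest ← to T-∧ now =
    from T-∨ (inj₁ (from T-∧ (≤⇒≤ᵇ (≤-trans lo′≤lo (≤ᵇ⇒≤ lo x lo≤x)) , rest)))
  ... | inj₂ later = from T-∨ (inj₂ (hasIncreasing-mono (suc k) xs lo′≤lo later))

  hasIncreasing-tail : ∀ k {lo} xs → T (hasIncreasing (suc k) lo xs) → T (hasIncreasing k (suc lo) xs)
  hasIncreasing-tail zero xs _ = tt
  hasIncreasing-tail (suc k) {lo} (x ∷ xs) t with to T-∨ t
  ... | inj₁ now with lo≤x , rest ← to T-∧ now =
    from T-∨ (inj₂ (hasIncreasing-mono (suc k) xs (s≤s (≤ᵇ⇒≤ lo x lo≤x)) rest))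
  ... | inj₂ later = from T-∨ (inj₂ (hasIncreasing-tail (suc k) xs later))

  anyB-++ : ∀ {A : Set} (p : A → Bool) xs ys → anyB p (xs ++ ys) ≡ anyB p xs ∨ anyB p ys
  anyB-++ p [] ys = refl
  anyB-++ p (x ∷ xs) ys rewrite anyB-++ p xs ys = sym (∨-assoc (p x) (anyB p xs) (anyB p ys))

  anyB-map : ∀ {A B : Set} (p : B → Bool) (f : A → B) xs → anyB p (map f xs) ≡ anyB (λ x → p (f x)) xs
  anyB-map p f [] = refl
  anyB-map p f (x ∷ xs) = cong (p (f x) ∨_) (anyB-map p f xs)

  anyB-∧ˡ : ∀ {A : Set} b (p : A → Bool) xs → anyB (λ x → b ∧ p x) xs ≡ b ∧ anyB p xs
  anyB-∧ˡ true p xs = refl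
  anyB-∧ˡ false p [] = refl
  anyB-∧ˡ false p (x ∷ xs) = anyB-∧ˡ false p xs

  anyB-cong : ∀ {A : Set} {p q : A → Bool} → (∀ x → p x ≡ q x) → ∀ xs → anyB p xs ≡ anyB q xs
  anyB-cong e [] = refl
  anyB-cong e (x ∷ xs) = cong₂ _∨_ (e x) (anyB-cong e xs)

  allB⇒All : ∀ {A : Set} (p : A → Bool) xs → T (allB p xs) → All (λ x → T (p x)) xs
  allB⇒All p [] _ = []
  allB⇒All p (x ∷ xs) t with px , pxs ← to T-∧ t = px ∷ allB⇒All p xs pxs

  anyB-increasing-subseqs : ∀ k lo π → anyB (increasing k lo) (subseqs π) ≡ hasIncreasing k lo π
  anyB-increasing-subseqs zero lo [] = refl
  anyB-increasing-subseqs zero lo (x ∷ π)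
    rewrite anyB-++ (increasing 0 lo) (map (x ∷_) (subseqs π)) (subseqs π)
          | anyB-increasing-subseqs 0 lo π = ∨-zeroʳ _
  anyB-increasing-subseqs (suc k) lo [] = refl
  anyB-increasing-subseqs (suc k) lo (x ∷ π) = begin
    anyB (increasing (suc k) lo) (map (x ∷_) (subseqs π) ++ subseqs π)
      ≡⟨ anyB-++ (increasing (suc k) lo) (map (x ∷_) (subseqs π)) (subseqs π) ⟩
    anyB (increasing (suc k) lo) (map (x ∷_) (subseqs π)) ∨ anyB (increasing (suc k) lo) (subseqs π)
      ≡⟨ cong₂ _∨_ (trans (anyB-map (increasing (suc k) lo) (x ∷_) (subseqs π))
                          (anyB-∧ˡ (lo ≤ᵇ x) (increasing k (suc x)) (subseqs π)))
                   (anyB-increasing-subseqs (suc k) lo π) ⟩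
    ((lo ≤ᵇ x) ∧ anyB (increasing k (suc x)) (subseqs π)) ∨ hasIncreasing (suc k) lo π
      ≡⟨ cong (λ b → ((lo ≤ᵇ x) ∧ b) ∨ hasIncreasing (suc k) lo π) (anyB-increasing-subseqs k (suc x) π) ⟩
    hasIncreasing (suc k) lo (x ∷ π) ∎
    where open ≡-Reasoning

  increasing-length : ∀ k lo s → T (increasing k lo s) → length s ≡ k
  increasing-length zero lo [] _ = refl
  increasing-length (suc k) lo (x ∷ s) t with _ , rest ← to (T-∧ {lo ≤ᵇ x}) t =
    cong suc (increasing-length k (suc x) s rest)

  τ : List ℕ
  τ = 0 ∷ 1 ∷ 2 ∷ 3 ∷ []

  -- The comparison of two positions made by orderIso in Defs (a local function there); allB over it is
  -- definitionally the body of orderIso.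
  agree : ℕ × ℕ → ℕ × ℕ → Bool
  agree (a , c) (b , d) = ((a <ᵇ b) ==ᵇ (c <ᵇ d)) ∧ ((b <ᵇ a) ==ᵇ (d <ᵇ c))

  agree-< : ∀ x y i j → T (i <ᵇ j) → T (agree (x , i) (y , j)) → T (x <ᵇ y)
  agree-< x y i j i<j t with x <ᵇ y | i <ᵇ j
  ... | true | _ = tt
  ... | false | true = t

  orderIso⇒increasing : ∀ s → T (orderIso s τ) → T (increasing 4 0 s)
  orderIso⇒increasing (a ∷ b ∷ c ∷ d ∷ []) t
    with All.map (λ {p} → allB⇒All (agree p) pairs) (allB⇒All (λ p → allB (agree p) pairs) pairs t)
    where pairs = (a , 0) ∷ (b , 1) ∷ (c , 2) ∷ (d , 3) ∷ []
  ... | (_ ∷ ab ∷ _) ∷ (_ ∷ _ ∷ bc ∷ _) ∷ (_ ∷ _ ∷ _ ∷ cd ∷ _) ∷ _ =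
    from T-∧ (agree-< a b 0 1 tt ab , from T-∧ (agree-< b c 1 2 tt bc , from T-∧ (agree-< c d 2 3 tt cd , tt)))

  chain⇒orderIso : ∀ {a b c d} → a < b → b < c → c < d → T (orderIso (a ∷ b ∷ c ∷ d ∷ []) τ)
  chain⇒orderIso {a} {b} {c} {d} a<b b<c c<d
    rewrite <ᵇ-true a<b | <ᵇ-true b<c | <ᵇ-true c<d
          | <ᵇ-true (<-trans a<b b<c) | <ᵇ-true (<-trans b<c c<d) | <ᵇ-true (<-trans a<b (<-trans b<c c<d))
          | <ᵇ-false (<⇒≤ a<b) | <ᵇ-false (<⇒≤ b<c) | <ᵇ-false (<⇒≤ c<d)
          | <ᵇ-false (<⇒≤ (<-trans a<b b<c)) | <ᵇ-false (<⇒≤ (<-trans b<c c<d))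
          | <ᵇ-false (<⇒≤ (<-trans a<b (<-trans b<c c<d)))
          | <ᵇ-false (≤-refl {a}) | <ᵇ-false (≤-refl {b}) | <ᵇ-false (≤-refl {c}) | <ᵇ-false (≤-refl {d}) = tt

  increasing⇒orderIso : ∀ s → T (increasing 4 0 s) → T (orderIso s τ)
  increasing⇒orderIso (a ∷ b ∷ c ∷ d ∷ []) t
    with ab , bcd ← to (T-∧ {a <ᵇ b}) t
    with bc , cd′ ← to (T-∧ {b <ᵇ c}) bcd
    with cd , _ ← to (T-∧ {c <ᵇ d}) cd′ = chain⇒orderIso (<ᵇ⇒< a b ab) (<ᵇ⇒< b c bc) (<ᵇ⇒< c d cd)
  increasing⇒orderIso s@[] t with () ← increasing-length 4 0 s t
  increasing⇒orderIso s@(_ ∷ []) t with () ← increasing-length 4 0 s t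
  increasing⇒orderIso s@(_ ∷ _ ∷ []) t with () ← increasing-length 4 0 s t
  increasing⇒orderIso s@(_ ∷ _ ∷ _ ∷ []) t with () ← increasing-length 4 0 s t
  increasing⇒orderIso s@(_ ∷ _ ∷ _ ∷ _ ∷ _ ∷ _) t with () ← increasing-length 4 0 s t

  contains-τ : ∀ π → contains π τ ≡ hasIncreasing 4 0 π
  contains-τ π = trans (anyB-cong (λ s → T-ext (orderIso⇒increasing s) (increasing⇒orderIso s)) (subseqs π))
                       (anyB-increasing-subseqs 4 0 π)

module Phases where
  open import Data.Nat using (_+_)
  open import Data.Nat.Properties
    using (+-assoc; +-suc; +-identityʳ; +-monoʳ-≤; m≤n+m; ≤-reflexive; ≤-refl; ≤-trans; ≤-pred; n≤1+n)
  open import Data.Bool.Properties using (∨-assoc)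
  open Booleans
  open Counting
  open IncreasingSubsequences

  -- a is the number of ascents so far and l the last entry so far
  continuesAscent : ℕ → ℕ → List ℕ → Bool
  continuesAscent a l [] = true
  continuesAscent a l (y ∷ ys) = (y ≤ᵇ suc a) ∧ continuesAscent (if l <ᵇ y then suc a else a) y ys

  lastOf : ℕ → List ℕ → ℕ
  lastOf p [] = p
  lastOf p (q ∷ qs) = lastOf q qs

  lastOf-∷ʳ : ∀ p ps y → lastOf p (ps ++ y ∷ []) ≡ y
  lastOf-∷ʳ p [] y = refl
  lastOf-∷ʳ p (q ∷ qs) y = lastOf-∷ʳ q qs y

  ascFrom-∷ʳ : ∀ p ps y →
    ascFrom p (ps ++ y ∷ []) ≡ (if lastOf p ps <ᵇ y then suc (ascFrom p ps) else ascFrom p ps)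
  ascFrom-∷ʳ p [] y with p <ᵇ y
  ... | true = refl
  ... | false = refl
  ascFrom-∷ʳ p (q ∷ qs) y rewrite ascFrom-∷ʳ q qs y with lastOf q qs <ᵇ y
  ... | true = +-suc (if p <ᵇ q then 1 else 0) (ascFrom q qs)
  ... | false = refl

  checkFrom-continuesAscent : ∀ p ps ys →
    checkFrom (p ∷ ps) ys ≡ continuesAscent (ascFrom p ps) (lastOf p ps) ys
  checkFrom-continuesAscent p ps [] = refl
  checkFrom-continuesAscent p ps (y ∷ ys)
    rewrite checkFrom-continuesAscent p (ps ++ y ∷ []) ys | ascFrom-∷ʳ p ps y | lastOf-∷ʳ p ps y = refl

  ≤-ifSuc : ∀ b a → a ≤ (if b then suc a else a)
  ≤-ifSuc true a = n≤1+n a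
  ≤-ifSuc false a = ≤-refl

  ifSuc-≤ : ∀ b a → (if b then suc a else a) ≤ suc a
  ifSuc-≤ true a = ≤-refl
  ifSuc-≤ false a = n≤1+n a

  continuesAscent-bounded : ∀ a l {lo} xs → lo ≤ 2 + a → hasIncreasing 1 lo xs ≡ false →
    continuesAscent a l xs ≡ true
  continuesAscent-bounded a l [] _ _ = refl
  continuesAscent-bounded a l {lo} (y ∷ ys) lo≤2+a none
    with lo ≤ᵇ y in lo≰y | hasIncreasing 1 lo ys in later
  ... | false | false rewrite ≤ᵇ-true (≤-pred (≤-trans (≤ᵇ-false⇒> lo≰y) lo≤2+a)) =
    continuesAscent-bounded _ y ys (≤-trans lo≤2+a (s≤s (s≤s (≤-ifSuc (l <ᵇ y) a)))) later

  -- The states of the two phases. beforeTwo a l: every entry so far is ≤ 1, with a ascents and last entry l.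
  -- afterTwo c: the least entry ≥ 2 so far is c + 1, so later entries must be ≤ c + 1 and later entries ≥ 2
  -- must not increase; the ascent condition can no longer fail.
  beforeTwo : ℕ → ℕ → List ℕ → Bool
  beforeTwo a l xs = continuesAscent a l xs ∧ not (hasIncreasing 2 2 xs)

  afterTwo : ℕ → List ℕ → Bool
  afterTwo c xs = not (hasIncreasing 1 (2 + c) xs ∨ hasIncreasing 2 2 xs)

  -- Before the first ascent, an entry 1 precedes every larger entry, so forbidding 123 is forbidding an
  -- increasing pair of entries ≥ 2.
  beforeTwo-noAscent : ∀ l xs → continuesAscent 0 l xs ∧ not (hasIncreasing 3 1 xs) ≡ beforeTwo 0 l xs
  beforeTwo-noAscent l [] = refl
  beforeTwo-noAscent l (0 ∷ xs) = beforeTwo-noAscent 0 xs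
  beforeTwo-noAscent l (1 ∷ xs) =
    cong (λ b → continuesAscent _ 1 xs ∧ not b) (∨-absorbʳ (hasIncreasing-tail 2 xs))
  beforeTwo-noAscent l (suc (suc y) ∷ xs) = refl

  ascentSeq∧avoids-τ : ∀ xs → isAscentSeq (0 ∷ xs) ∧ avoids (0 ∷ xs) τ ≡ beforeTwo 0 0 xs
  ascentSeq∧avoids-τ xs = begin
    isAscentSeq (0 ∷ xs) ∧ not (contains (0 ∷ xs) τ)
      ≡⟨ cong₂ (λ u v → u ∧ not v) (checkFrom-continuesAscent 0 [] xs)
                                   (trans (contains-τ (0 ∷ xs)) (∨-absorbʳ (hasIncreasing-tail 3 xs))) ⟩
    continuesAscent 0 0 xs ∧ not (hasIncreasing 3 1 xs)
      ≡⟨ beforeTwo-noAscent 0 xs ⟩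
    beforeTwo 0 0 xs ∎
    where open ≡-Reasoning

  afterTwo-bounded : ∀ c xs → afterTwo c xs ≡ true → hasIncreasing 1 (2 + c) xs ≡ false
  afterTwo-bounded c xs after with hasIncreasing 1 (2 + c) xs
  ... | false = refl

  beforeTwo-dead : ∀ {a l} y xs → 2 + a ≤ y → beforeTwo a l (y ∷ xs) ≡ false
  beforeTwo-dead (suc (suc j)) xs (s≤s (s≤s a≤j)) rewrite <ᵇ-false a≤j = refl

  beforeTwo-large : ∀ {a} l {j} xs → j < a → beforeTwo a l (2 + j ∷ xs) ≡ afterTwo (suc j) xs
  beforeTwo-large {a} l {j} xs j<a rewrite <ᵇ-true j<a =
    ∧-absorbˡ (λ after → continuesAscent-bounded _ _ xs (s≤s (s≤s (≤-trans j<a (≤-ifSuc (l <ᵇ 2 + j) a))))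
                                                     (afterTwo-bounded (suc j) xs after))

  afterTwo-dead : ∀ {c} y xs → 2 + c ≤ y → afterTwo c (y ∷ xs) ≡ false
  afterTwo-dead y xs 2+c≤y rewrite <ᵇ-true 2+c≤y = refl

  afterTwo-large : ∀ {c j} xs → j < c → afterTwo c (2 + j ∷ xs) ≡ afterTwo (suc j) xs
  afterTwo-large {c} {j} xs j<c rewrite <ᵇ-false j<c =
    cong not (trans (sym (∨-assoc (hasIncreasing 1 (2 + c) xs) _ _))
                    (cong (_∨ hasIncreasing 2 2 xs) (∨-absorbˡ (hasIncreasing-mono 1 xs (s≤s (s≤s j<c))))))

  afterTwoCount : ℕ → ℕ → ℕ
  afterTwoCount c zero = 1
  afterTwoCount c (suc k) =
    afterTwoCount c k + afterTwoCount c k + sum (applyUpTo (λ j → afterTwoCount (suc j) k) c)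

  afterTwoSum : ℕ → ℕ → ℕ
  afterTwoSum a k = sum (applyUpTo (λ j → afterTwoCount (suc j) k) a)

  beforeTwoCount : ℕ → ℕ → ℕ → ℕ
  beforeTwoCount a l zero = 1
  beforeTwoCount a l (suc k) =
    beforeTwoCount a 0 k + beforeTwoCount (if l <ᵇ 1 then suc a else a) 1 k + afterTwoSum a k

  count-afterTwo : ∀ k c {B} → 2 + c ≤ B → count (afterTwo c) (listsOf B k) ≡ afterTwoCount c k
  count-afterTwo zero c _ = refl
  count-afterTwo (suc k) c {B} 2+c≤B = begin
    count (afterTwo c) (listsOf B (suc k))
      ≡⟨ count-listsOf-suc k (afterTwo c) 2+c≤B afterTwo-dead ⟩
    sum (applyUpTo (λ y → count (λ xs → afterTwo c (y ∷ xs)) (listsOf B k)) (2 + c))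
      ≡⟨ cong₂ (λ u v → u + (u + v)) (count-afterTwo k c 2+c≤B) (sum-applyUpTo-cong c large) ⟩
    afterTwoCount c k + (afterTwoCount c k + afterTwoSum c k)
      ≡⟨ +-assoc (afterTwoCount c k) _ _ ⟨
    afterTwoCount c (suc k) ∎
    where
    open ≡-Reasoning
    large : ∀ j → j < c → count (λ xs → afterTwo c (2 + j ∷ xs)) (listsOf B k) ≡ afterTwoCount (suc j) k
    large j j<c = trans (count-cong (λ xs → afterTwo-large xs j<c) (listsOf B k))
                        (count-afterTwo k (suc j) (≤-trans (s≤s (s≤s j<c)) 2+c≤B))

  count-beforeTwo : ∀ k a l {B} → k + a < B → count (beforeTwo a l) (listsOf B k) ≡ beforeTwoCount a l k
  count-beforeTwo zero a l _ = refl
  count-beforeTwo (suc k) a l {B} k+a<B = begin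
    count (beforeTwo a l) (listsOf B (suc k))
      ≡⟨ count-listsOf-suc k (beforeTwo a l) 2+a≤B beforeTwo-dead ⟩
    sum (applyUpTo (λ y → count (λ xs → beforeTwo a l (y ∷ xs)) (listsOf B k)) (2 + a))
      ≡⟨ cong₂ _+_ (count-beforeTwo k a 0 (≤-trans (n≤1+n _) k+a<B))
                   (cong₂ _+_ (count-beforeTwo k a′ 1 k+a′<B) (sum-applyUpTo-cong a large)) ⟩
    beforeTwoCount a 0 k + (beforeTwoCount a′ 1 k + afterTwoSum a k)
      ≡⟨ +-assoc (beforeTwoCount a 0 k) _ _ ⟨
    beforeTwoCount a l (suc k) ∎
    where
    open ≡-Reasoning
    a′ = if l <ᵇ 1 then suc a else a
    2+a≤B : 2 + a ≤ B
    2+a≤B = ≤-trans (s≤s (s≤s (m≤n+m a k))) k+a<B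
    k+a′<B : k + a′ < B
    k+a′<B = ≤-trans (s≤s (≤-trans (+-monoʳ-≤ k (ifSuc-≤ (l <ᵇ 1) a)) (≤-reflexive (+-suc k a)))) k+a<B
    large : ∀ j → j < a → count (λ xs → beforeTwo a l (2 + j ∷ xs)) (listsOf B k) ≡ afterTwoCount (suc j) k
    large j j<a = trans (count-cong (λ xs → beforeTwo-large l xs j<a) (listsOf B k))
                        (count-afterTwo k (suc j) (≤-trans (s≤s (s≤s j<a)) 2+a≤B))

  A-τ-suc : ∀ n → A τ (suc n) ≡ beforeTwoCount 0 0 n
  A-τ-suc n = begin
    A τ (suc n)
      ≡⟨ length-filter-filter isAscentSeq (λ x → avoids x τ) (listsOf (2 + n) (suc n)) ⟩
    count (λ x → isAscentSeq x ∧ avoids x τ) (listsOf (2 + n) (suc n))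
      ≡⟨ count-listsOf-suc n _ (s≤s z≤n) (λ { (suc y) xs _ → refl }) ⟩
    count (λ xs → isAscentSeq (0 ∷ xs) ∧ avoids (0 ∷ xs) τ) (listsOf (2 + n) n) + 0
      ≡⟨ +-identityʳ _ ⟩
    count (λ xs → isAscentSeq (0 ∷ xs) ∧ avoids (0 ∷ xs) τ) (listsOf (2 + n) n)
      ≡⟨ count-cong ascentSeq∧avoids-τ (listsOf (2 + n) n) ⟩
    count (beforeTwo 0 0) (listsOf (2 + n) n)
      ≡⟨ count-beforeTwo n 0 0 (s≤s (≤-trans (≤-reflexive (+-identityʳ n)) (n≤1+n n))) ⟩
    beforeTwoCount 0 0 n ∎
    where open ≡-Reasoning

open Counting using (sum-applyUpTo-suc)
open IncreasingSubsequences using (τ)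
open Phases using (beforeTwoCount; afterTwoCount; afterTwoSum; A-τ-suc)

import Data.Nat as ℕ
open import Data.Integer using (ℤ; +_; _+_; _-_; _*_)
open import Data.Integer.Properties using (pos-+)
open import Data.Integer.Tactic.RingSolver using (solve-∀; solve)

Family : Set
Family = ℕ → ℕ → ℤ

infixl 6 _⊕_
_⊕_ : Family → Family → Family
(X ⊕ Y) α k = X α k + Y α k

-- The coefficient of x^(k+1) in (1 − 3x) X_(α+1) − (1 − 2x) X_α, with X_α = Σ_k X α k xᵏ.
twist : Family → ℕ → ℕ → ℤ
twist X α k = X (suc α) (suc k) - + 3 * X (suc α) k - X α (suc k) + + 2 * X α k

twist-cong : ∀ {X Y} → (∀ α k → X α k ≡ Y α k) → ∀ α k → twist X α k ≡ twist Y α k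
twist-cong e α k rewrite e (suc α) (suc k) | e (suc α) k | e α (suc k) | e α k = refl

twist-⊕ : ∀ X Y α k → twist (X ⊕ Y) α k ≡ twist X α k + twist Y α k
twist-⊕ X Y α k = linear (X (suc α) (suc k)) (Y (suc α) (suc k)) (X (suc α) k) (Y (suc α) k)
                         (X α (suc k)) (Y α (suc k)) (X α k) (Y α k)
  where
  linear : ∀ a a′ b b′ c c′ d d′ →
    (a + a′) - + 3 * (b + b′) - (c + c′) + + 2 * (d + d′)
      ≡ (a - + 3 * b - c + + 2 * d) + (a′ - + 3 * b′ - c′ + + 2 * d′)
  linear = solve-∀

twist-step : ∀ {X Y Z W} → (∀ α k → X α (suc k) ≡ (Y ⊕ Z ⊕ W) α k) →
  ∀ α k → twist X α (suc k) ≡ twist Y α k + twist Z α k + twist W α k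
twist-step {X} {Y} {Z} {W} step α k = begin
  twist X α (suc k)                        ≡⟨ twist-cong step α k ⟩
  twist (Y ⊕ Z ⊕ W) α k                    ≡⟨ twist-⊕ (Y ⊕ Z) W α k ⟩
  twist (Y ⊕ Z) α k + twist W α k          ≡⟨ cong (_+ twist W α k) (twist-⊕ Y Z α k) ⟩
  twist Y α k + twist Z α k + twist W α k  ∎
  where open ≡-Reasoning

pos-+₃ : ∀ x y z → + (x ℕ.+ y ℕ.+ z) ≡ + x + + y + + z
pos-+₃ x y z = trans (pos-+ (x ℕ.+ y) z) (cong (_+ + z) (pos-+ x y))

-- Opaque so that the integer arithmetic below does not compute through the casts; from here on the families
-- are used only through these equations.
opaque
  U V G S : Family
  U α k = + beforeTwoCount α 1 k
  V α k = + beforeTwoCount α 0 k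
  G c k = + afterTwoCount c k
  S α k = + afterTwoSum α k

  U-step : ∀ α k → U α (suc k) ≡ (V ⊕ U ⊕ S) α k
  U-step α k = pos-+₃ (beforeTwoCount α 0 k) (beforeTwoCount α 1 k) (afterTwoSum α k)

  V-step : ∀ α k → V α (suc k) ≡ (V ⊕ (λ α → U (suc α)) ⊕ S) α k
  V-step α k = pos-+₃ (beforeTwoCount α 0 k) (beforeTwoCount (suc α) 1 k) (afterTwoSum α k)

  G-step : ∀ c k → G c (suc k) ≡ (G ⊕ G ⊕ S) c k
  G-step c k = pos-+₃ (afterTwoCount c k) (afterTwoCount c k) (afterTwoSum c k)

  S-step : ∀ α k → S (suc α) k ≡ S α k + G (suc α) k
  S-step α k = trans (cong +_ (sum-applyUpTo-suc (λ j → afterTwoCount (suc j) k) α))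
                     (pos-+ (afterTwoSum α k) (afterTwoCount (suc α) k))

  U-zero : ∀ α → U α 0 ≡ + 1
  U-zero α = refl

  V-zero : ∀ α → V α 0 ≡ + 1
  V-zero α = refl

  G-zero : ∀ c → G c 0 ≡ + 1
  G-zero c = refl

  S-zero : ∀ k → S 0 k ≡ + 0
  S-zero k = refl

  A-τ-V : ∀ n → + A τ (suc n) ≡ V 0 n
  A-τ-V n = cong +_ (A-τ-suc n)

twist-S : ∀ α k → twist S α k ≡ + 0
twist-S α k = telescope (S-step α (suc k)) (G-step (suc α) k) (S-step α k)
  where
  telescope : ∀ {s₁₁ s₁₀ s₀₁ s₀₀ g₁ g₀} → s₁₁ ≡ s₀₁ + g₁ → g₁ ≡ g₀ + g₀ + s₁₀ → s₁₀ ≡ s₀₀ + g₀ →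
    s₁₁ - + 3 * s₁₀ - s₀₁ + + 2 * s₀₀ ≡ + 0
  telescope {s₀₁ = s₀₁} {s₀₀} {g₀ = g₀} refl refl refl = solve (s₀₁ ∷ s₀₀ ∷ g₀ ∷ [])

twist-initial : ∀ {X} → (∀ α → X α 0 ≡ + 1) → (∀ α → X α 1 ≡ + 1 + + 1 + S α 0) → ∀ α → twist X α 0 ≡ + 0
twist-initial zero₀ one₀ α =
  start {s = S α 0} (zero₀ (suc α)) (zero₀ α) (one₀ (suc α)) (one₀ α)
        (trans (S-step α 0) (cong (λ g → S α 0 + g) (G-zero (suc α))))
  where
  start : ∀ {a₁ a₀ b₁ b₀ s′ s} → a₀ ≡ + 1 → b₀ ≡ + 1 → a₁ ≡ + 1 + + 1 + s′ → b₁ ≡ + 1 + + 1 + s →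
    s′ ≡ s + + 1 → a₁ - + 3 * a₀ - b₁ + + 2 * b₀ ≡ + 0
  start {s = s} refl refl refl refl refl = solve (s ∷ [])

sum-of-zeros : ∀ {t x y z : ℤ} → t ≡ x + y + z → x ≡ + 0 → y ≡ + 0 → z ≡ + 0 → t ≡ + 0
sum-of-zeros refl refl refl refl = refl

mutual
  twist-U : ∀ k α → twist U α k ≡ + 0
  twist-U zero = twist-initial {U} U-zero
    (λ α → trans (U-step α 0) (cong₂ (λ v u → v + u + S α 0) (V-zero α) (U-zero α)))
  twist-U (suc k) α =
    sum-of-zeros (twist-step {U} {V} {U} {S} U-step α k) (twist-V k α) (twist-U k α) (twist-S α k)

  twist-V : ∀ k α → twist V α k ≡ + 0
  twist-V zero = twist-initial {V} V-zero
    (λ α → trans (V-step α 0) (cong₂ (λ v u → v + u + S α 0) (V-zero α) (U-zero (suc α))))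
  twist-V (suc k) α =
    sum-of-zeros (twist-step {V} {V} {λ α → U (suc α)} {S} V-step α k) (twist-V k α) (twist-U k (suc α)) (twist-S α k)

U-geometric : ∀ α k → U (suc α) (suc k) ≡ + 3 * U (suc α) k + U α (suc k) - + 2 * U α k
U-geometric α k = isolate (twist-U k α)
  where
  isolate : ∀ {a b c d} → a - + 3 * b - c + + 2 * d ≡ + 0 → a ≡ + 3 * b + c - + 2 * d
  isolate {a} {b} {c} {d} h = begin
    a                                                     ≡⟨ solve (a ∷ b ∷ c ∷ d ∷ []) ⟩
    (a - + 3 * b - c + + 2 * d) + (+ 3 * b + c - + 2 * d) ≡⟨ cong (_+ (+ 3 * b + c - + 2 * d)) h ⟩
    + 0 + (+ 3 * b + c - + 2 * d)                         ≡⟨ solve (b ∷ c ∷ d ∷ []) ⟩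
    + 3 * b + c - + 2 * d                                 ∎
    where open ≡-Reasoning

Recurrence : (ℕ → ℤ) → Set
Recurrence a = ∀ i → a (3 ℕ.+ i) ≡ + 5 * a (2 ℕ.+ i) - + 6 * a (1 ℕ.+ i) + a i

Recurrence-cong : ∀ {a b} → (∀ n → a n ≡ b n) → Recurrence b → Recurrence a
Recurrence-cong e rec i rewrite e (3 ℕ.+ i) | e (2 ℕ.+ i) | e (1 ℕ.+ i) | e i = rec i

-- Eliminating U_0 and U_1 from (1 − x) U_0 = 1 + x V_0, (1 − x) V_0 = 1 + x U_1 and
-- (1 − 3x) U_1 = (1 − 2x) U_0, coefficientwise.
V₀-recurrence : Recurrence (V 0)
V₀-recurrence i =
  eliminate (V-step 0 i) (V-step 0 (1 ℕ.+ i)) (V-step 0 (2 ℕ.+ i)) (U-step 0 i) (U-step 0 (1 ℕ.+ i))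
            (U-geometric 0 i) (U-geometric 0 (1 ℕ.+ i)) (S-zero i) (S-zero (1 ℕ.+ i)) (S-zero (2 ℕ.+ i))
  where
  eliminate : ∀ {v₃ v₂ v₁ v₀ w₂ w₁ w₀ u₂ u₁ u₀ s₂ s₁ s₀} →
    v₁ ≡ v₀ + w₀ + s₀ → v₂ ≡ v₁ + w₁ + s₁ → v₃ ≡ v₂ + w₂ + s₂ → u₁ ≡ v₀ + u₀ + s₀ → u₂ ≡ v₁ + u₁ + s₁ →
    w₁ ≡ + 3 * w₀ + u₁ - + 2 * u₀ → w₂ ≡ + 3 * w₁ + u₂ - + 2 * u₁ → s₀ ≡ + 0 → s₁ ≡ + 0 → s₂ ≡ + 0 →
    v₃ ≡ + 5 * v₂ - + 6 * v₁ + v₀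
  eliminate {v₀ = v₀} {w₀ = w₀} {u₀ = u₀} refl refl refl refl refl refl refl refl refl refl =
    solve (v₀ ∷ w₀ ∷ u₀ ∷ [])

theorem4 : A (0 ∷ 1 ∷ 2 ∷ 3 ∷ []) 0 ≡ 1
    × A (0 ∷ 1 ∷ 2 ∷ 3 ∷ []) 1 ≡ 1
    × A (0 ∷ 1 ∷ 2 ∷ 3 ∷ []) 2 ≡ 2
    × ((n : ℕ) → 3 ≤ n →
        + A (0 ∷ 1 ∷ 2 ∷ 3 ∷ []) n
          ≡ + 5 * + A (0 ∷ 1 ∷ 2 ∷ 3 ∷ []) (n ∸ 1)
            - + 6 * + A (0 ∷ 1 ∷ 2 ∷ 3 ∷ []) (n ∸ 2)
            + + A (0 ∷ 1 ∷ 2 ∷ 3 ∷ []) (n ∸ 3))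
theorem4 = refl , refl , refl , recurrence
  where
  recurrence : (n : ℕ) → 3 ≤ n → + A τ n ≡ + 5 * + A τ (n ∸ 1) - + 6 * + A τ (n ∸ 2) + + A τ (n ∸ 3)
  recurrence 3 (s≤s (s≤s (s≤s z≤n))) = refl
  recurrence (suc (suc (suc (suc i)))) (s≤s (s≤s (s≤s z≤n))) = Recurrence-cong A-τ-V V₀-recurrence i
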